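{- Let $p_1,p_2,p_3,p_4\in\mathbb{R}^3$ be such that the affine planes $\pi_1=\mathrm{span}(p_1,p_2,p_3)$ and $\pi_2=\mathrm{span}(p_1,p_2,p_4)$ are both $2$-dimensional and do not pass through the origin $O$. Then the projective lifting coefficient \[ \omega(p_1,p_2;p_3,p_4)=\frac{\det(p_2-p_1,\,p_3-p_1,\,p_4-p_1)}{\det(p_1,p_2,p_3)\,\det(p_1,p_2,p_4)} \] does not depend on the choice of the points $p_3\in\pi_1\setminus\pi_2$ and $p_4\in\pi_2\setminus\pi_1$; that is, for any $p_3'\in\pi_1\setminus\pi_2$ and $p_4'\in\pi_2\setminus\pi_1$ we have $\omega(p_1,p_2;p_3',p_4')=\omega(p_1,p_2;p_3,p_4)$.
   Context: $\mathrm{span}(W)$ denotes the smallest affine subspace containing the set $W$. Points of $\mathbb{R}^3$ are identified with column vectors, and $\det$ of three vectors is the determinant of the $3\times 3$ matrix with these columns. -}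

module Defs where

open import Level using (Level; suc; _⊔_)
open import Algebra.Bundles using (CommutativeRing)
open import Data.Product using (_×_; _,_; ∃-syntax)
open import Relation.Nullary using (¬_)

-- A field: a commutative ring with 1 ≉ 0 and a (total) inverse operation
-- such that every nonzero element is invertible.  (Value of 0⁻¹ irrelevant.)
record Field (c ℓ : Level) : Set (suc (c ⊔ ℓ)) where
  field
    commutativeRing : CommutativeRing c ℓ
  open CommutativeRing commutativeRing public
  field
    _⁻¹       : Carrier → Carrier
    1≉0       : ¬ (1# ≈ 0#)
    ⁻¹-inverse : ∀ x → ¬ (x ≈ 0#) → x * (x ⁻¹) ≈ 1#

module Geometry {c ℓ : Level} (F : Field c ℓ) where
  open Field F

  Point : Set c
  Point = Carrier × Carrier × Carrier

  _⊕_ : Point → Point → Point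
  (a₁ , a₂ , a₃) ⊕ (b₁ , b₂ , b₃) = (a₁ + b₁ , a₂ + b₂ , a₃ + b₃)

  _⊖_ : Point → Point → Point
  (a₁ , a₂ , a₃) ⊖ (b₁ , b₂ , b₃) = (a₁ - b₁ , a₂ - b₂ , a₃ - b₃)

  _·_ : Carrier → Point → Point
  s · (a₁ , a₂ , a₃) = (s * a₁ , s * a₂ , s * a₃)

  origin : Point
  origin = (0# , 0# , 0#)

  _≈ₚ_ : Point → Point → Set ℓ
  (a₁ , a₂ , a₃) ≈ₚ (b₁ , b₂ , b₃) = (a₁ ≈ b₁) × (a₂ ≈ b₂) × (a₃ ≈ b₃)

  det : Point → Point → Point → Carrier
  det (a₁ , a₂ , a₃) (b₁ , b₂ , b₃) (c₁ , c₂ , c₃) =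
    a₁ * (b₂ * c₃ - c₂ * b₃) - b₁ * (a₂ * c₃ - c₂ * a₃) + c₁ * (a₂ * b₃ - b₂ * a₃)

  InSpan3 : Point → Point → Point → Point → Set (c ⊔ ℓ)
  InSpan3 a b d x = ∃[ s ] ∃[ t ] ∃[ u ]
    ((s + t + u ≈ 1#) × (x ≈ₚ ((s · a) ⊕ ((t · b) ⊕ (u · d)))))

  TwoDimensional : Point → Point → Point → Set (c ⊔ ℓ)
  TwoDimensional a b d = ∀ s t →
    ((s · (b ⊖ a)) ⊕ (t · (d ⊖ a))) ≈ₚ origin → (s ≈ 0#) × (t ≈ 0#)

  ω : Point → Point → Point → Point → Carrier
  ω p₁ p₂ p₃ p₄ =
    det (p₂ ⊖ p₁) (p₃ ⊖ p₁) (p₄ ⊖ p₁) * ((det p₁ p₂ p₃ * det p₁ p₂ p₄) ⁻¹)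

{-# OPTIONS --safe #-}
-- Write p₃′ = s p₁ + t p₂ + u p₃ and p₄′ = s′ p₁ + t′ p₂ + u′ p₄ with
-- s + t + u = s′ + t′ + u′ = 1.  Since det is alternating and multilinear,
-- det(p₁,p₂,p₃′) = u det(p₁,p₂,p₃), det(p₁,p₂,p₄′) = u′ det(p₁,p₂,p₄) and the
-- numerator of ω picks up the factor u u′ as well; u, u′ ≠ 0 because p₃′ ∉ π₂
-- and p₄′ ∉ π₁.  It remains that det(p₁,p₂,p₃) ≠ 0: if it vanished, Cramer's
-- rule with any x completing p₂ - p₁, p₃ - p₁ to a basis would write p₁ as a
-- linear combination of p₂ - p₁ and p₃ - p₁, putting O on π₁.
module Submission where

open import Defs
open import Level using (Level; _⊔_)
open import Algebra.Bundles using (CommutativeRing)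
open import Data.Nat.Base as ℕ using (ℕ; zero; suc)
import Data.Nat.Properties as ℕ
open import Data.Integer.Base as ℤ using (ℤ; +_; -[1+_])
import Data.Integer.Properties as ℤ
open import Data.Maybe.Base using (Maybe; just; nothing)
open import Data.Product using (_×_; _,_; proj₁; proj₂)
open import Relation.Nullary using (¬_; yes; no)
open import Relation.Binary.PropositionalEquality using (cong) renaming (refl to ≡-refl)
import Algebra.Properties.Ring as RingProperties
import Algebra.Properties.CommutativeSemigroup as CommutativeSemigroupProperties
import Algebra.Properties.Semiring.Mult.TCOptimised as Multiples
open import Algebra.Solver.Ring.AlmostCommutativeRing
  using (fromCommutativeRing; _-Raw-AlmostCommutative⟶_)
import Algebra.Solver.Ring as RingSolver
import Relation.Binary.Reasoning.Setoid as SetoidReasoning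

-- Coefficients are taken in ℤ, whose equality is decidable, so that the solver
-- can cancel numerals in a ring whose own equality need not be.
module IntegerCoefficientSolver {c ℓ : Level} (R : CommutativeRing c ℓ) where
  open CommutativeRing R
  open RingProperties ring using (-0#≈0#; -‿involutive; -‿+-comm; -‿distribˡ-*; -‿distribʳ-*)
  open CommutativeSemigroupProperties +-commutativeSemigroup using (interchange)
  open Multiples semiring using (1+×; ×-homo-+; ×1-homo-*) renaming (_×_ to _×ₙ_)
  open SetoidReasoning setoid

  ⟦_⟧ℤ : ℤ → Carrier
  ⟦ + n ⟧ℤ     = n ×ₙ 1#
  ⟦ -[1+ n ] ⟧ℤ = - (suc n ×ₙ 1#)

  [z+x]-[z+y]≈x-y : ∀ z x y → (z + x) - (z + y) ≈ x - y
  [z+x]-[z+y]≈x-y z x y = begin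
    (z + x) - (z + y)     ≈⟨ +-congˡ (-‿+-comm z y) ⟨
    (z + x) + (- z - y)   ≈⟨ interchange z x (- z) (- y) ⟩
    (z - z) + (x - y)     ≈⟨ +-congʳ (-‿inverseʳ z) ⟩
    0# + (x - y)          ≈⟨ +-identityˡ (x - y) ⟩
    x - y                 ∎

  ⊖-homo : ∀ m n → ⟦ m ℤ.⊖ n ⟧ℤ ≈ m ×ₙ 1# - n ×ₙ 1#
  ⊖-homo zero    zero    = sym (-‿inverseʳ 0#)
  ⊖-homo zero    (suc n) = sym (+-identityˡ _)
  ⊖-homo (suc m) zero    = sym (trans (+-congˡ -0#≈0#) (+-identityʳ _))
  ⊖-homo (suc m) (suc n) = begin
    ⟦ suc m ℤ.⊖ suc n ⟧ℤ                  ≡⟨ cong ⟦_⟧ℤ (ℤ.[1+m]⊖[1+n]≡m⊖n m n) ⟩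
    ⟦ m ℤ.⊖ n ⟧ℤ                          ≈⟨ ⊖-homo m n ⟩
    m ×ₙ 1# - n ×ₙ 1#                     ≈⟨ [z+x]-[z+y]≈x-y 1# _ _ ⟨
    (1# + m ×ₙ 1#) - (1# + n ×ₙ 1#)       ≈⟨ +-cong (1+× m 1#) (-‿cong (1+× n 1#)) ⟨
    suc m ×ₙ 1# - suc n ×ₙ 1#             ∎

  +-homo : ∀ i j → ⟦ i ℤ.+ j ⟧ℤ ≈ ⟦ i ⟧ℤ + ⟦ j ⟧ℤ
  +-homo (+ m)     (+ n)     = ×-homo-+ 1# m n
  +-homo (+ m)     -[1+ n ]  = ⊖-homo m (suc n)
  +-homo -[1+ m ]  (+ n)     = trans (⊖-homo n (suc m)) (+-comm _ _)
  +-homo -[1+ m ]  -[1+ n ]  = begin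
    - (suc (suc (m ℕ.+ n)) ×ₙ 1#)      ≡⟨ cong (λ k → - (k ×ₙ 1#)) (ℕ.+-suc (suc m) n) ⟨
    - ((suc m ℕ.+ suc n) ×ₙ 1#)        ≈⟨ -‿cong (×-homo-+ 1# (suc m) (suc n)) ⟩
    - (suc m ×ₙ 1# + suc n ×ₙ 1#)      ≈⟨ -‿+-comm _ _ ⟨
    - (suc m ×ₙ 1#) - suc n ×ₙ 1#      ∎

  *-homo : ∀ i j → ⟦ i ℤ.* j ⟧ℤ ≈ ⟦ i ⟧ℤ * ⟦ j ⟧ℤ
  *-homo (+ zero)  j         = sym (zeroˡ _)
  *-homo (+ suc m) (+ zero)  rewrite ℕ.*-zeroʳ m = sym (zeroʳ _)
  *-homo -[1+ m ]  (+ zero)  rewrite ℕ.*-zeroʳ m = sym (zeroʳ _)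
  *-homo (+ suc m) (+ suc n) = ×1-homo-* (suc m) (suc n)
  *-homo (+ suc m) -[1+ n ]  = trans (-‿cong (×1-homo-* (suc m) (suc n))) (-‿distribʳ-* _ _)
  *-homo -[1+ m ]  (+ suc n) = trans (-‿cong (×1-homo-* (suc m) (suc n))) (-‿distribˡ-* _ _)
  *-homo -[1+ m ]  -[1+ n ]  = begin
    (suc m ℕ.* suc n) ×ₙ 1#                  ≈⟨ ×1-homo-* (suc m) (suc n) ⟩
    (suc m ×ₙ 1#) * (suc n ×ₙ 1#)            ≈⟨ -‿involutive _ ⟨
    - - ((suc m ×ₙ 1#) * (suc n ×ₙ 1#))      ≈⟨ -‿cong (-‿distribʳ-* _ _) ⟩
    - ((suc m ×ₙ 1#) * - (suc n ×ₙ 1#))      ≈⟨ -‿distribˡ-* _ _ ⟩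
    - (suc m ×ₙ 1#) * - (suc n ×ₙ 1#)        ∎

  -‿homo : ∀ i → ⟦ ℤ.- i ⟧ℤ ≈ - ⟦ i ⟧ℤ
  -‿homo (+ zero)  = sym -0#≈0#
  -‿homo (+ suc n) = refl
  -‿homo -[1+ n ]  = sym (-‿involutive _)

  ℤ-homomorphism : ℤ.+-*-rawRing -Raw-AlmostCommutative⟶ fromCommutativeRing R
  ℤ-homomorphism = record
    { ⟦_⟧ = ⟦_⟧ℤ ; +-homo = +-homo ; *-homo = *-homo ; -‿homo = -‿homo
    ; 0-homo = refl ; 1-homo = refl }

  coefficient≟ : ∀ i j → Maybe (⟦ i ⟧ℤ ≈ ⟦ j ⟧ℤ)
  coefficient≟ i j with i ℤ.≟ j
  ... | yes ≡-refl = just refl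
  ... | no _       = nothing

  open RingSolver ℤ.+-*-rawRing (fromCommutativeRing R) ℤ-homomorphism coefficient≟ public

-- Geometry's coordinate operations on solver syntax: evaluating these terms
-- gives Geometry's operations definitionally, so `solve … refl` proves
-- identities stated with det, ⊕, ⊖ and ·.
module SymbolicCoordinates {c ℓ : Level} (R : CommutativeRing c ℓ) (n : ℕ) where
  open IntegerCoefficientSolver R using (Polynomial; con; _:=_; _:+_; _:*_; _:-_)

  Vec3 : Set
  Vec3 = Polynomial n × Polynomial n × Polynomial n

  _:⊕_ _:⊖_ : Vec3 → Vec3 → Vec3
  (a₁ , a₂ , a₃) :⊕ (b₁ , b₂ , b₃) = (a₁ :+ b₁ , a₂ :+ b₂ , a₃ :+ b₃)
  (a₁ , a₂ , a₃) :⊖ (b₁ , b₂ , b₃) = (a₁ :- b₁ , a₂ :- b₂ , a₃ :- b₃)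

  _:·_ : Polynomial n → Vec3 → Vec3
  s :· (a₁ , a₂ , a₃) = (s :* a₁ , s :* a₂ , s :* a₃)

  Equation : Set
  Equation = Polynomial n × Polynomial n

  _:=ₚ_ : Vec3 → Vec3 → Equation × Equation × Equation
  (a₁ , a₂ , a₃) :=ₚ (b₁ , b₂ , b₃) = (a₁ := b₁) , (a₂ := b₂) , (a₃ := b₃)

  :e₁ :e₂ :e₃ : Vec3
  :e₁ = (con (+ 1) , con (+ 0) , con (+ 0))
  :e₂ = (con (+ 0) , con (+ 1) , con (+ 0))
  :e₃ = (con (+ 0) , con (+ 0) , con (+ 1))

  :det : Vec3 → Vec3 → Vec3 → Polynomial n
  :det (a₁ , a₂ , a₃) (b₁ , b₂ , b₃) (c₁ , c₂ , c₃) =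
    a₁ :* (b₂ :* c₃ :- c₂ :* b₃) :- b₁ :* (a₂ :* c₃ :- c₂ :* a₃) :+ c₁ :* (a₂ :* b₃ :- b₂ :* a₃)

module AffineGeometry {c ℓ : Level} (F : Field c ℓ) where
  open Field F
  open Geometry F
  open IntegerCoefficientSolver commutativeRing
    using (solve; _:=_; con; _:+_; _:*_; _:-_; :-_)
  open CommutativeSemigroupProperties *-commutativeSemigroup
    using () renaming (interchange to *-interchange)
  open SetoidReasoning setoid

  open module Symbolic {n : ℕ} = SymbolicCoordinates commutativeRing n

  ≈ₚ-refl : ∀ {p} → p ≈ₚ p
  ≈ₚ-refl = refl , refl , refl

  det-cong : ∀ {x x′ y y′ z z′} → x ≈ₚ x′ → y ≈ₚ y′ → z ≈ₚ z′ → det x y z ≈ det x′ y′ z′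
  det-cong (x₁ , x₂ , x₃) (y₁ , y₂ , y₃) (z₁ , z₂ , z₃) =
    +-cong (sub-cong (*-cong x₁ (sub-cong (*-cong y₂ z₃) (*-cong z₂ y₃)))
                     (*-cong y₁ (sub-cong (*-cong x₂ z₃) (*-cong z₂ x₃))))
           (*-cong z₁ (sub-cong (*-cong x₂ y₃) (*-cong y₂ x₃)))
    where
    sub-cong : ∀ {a a′ b b′} → a ≈ a′ → b ≈ b′ → a - b ≈ a′ - b′
    sub-cong a≈ b≈ = +-cong a≈ (-‿cong b≈)

  cramer : ∀ x v w a → (det x v w · a) ≈ₚ ((det a v w · x) ⊕ ((det x a w · v) ⊕ (det x v a · w)))
  cramer (x₁ , x₂ , x₃) (v₁ , v₂ , v₃) (w₁ , w₂ , w₃) (a₁ , a₂ , a₃) =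
      solve 12 (λ x₁ x₂ x₃ v₁ v₂ v₃ w₁ w₂ w₃ a₁ a₂ a₃ →
                  proj₁ (equations (x₁ , x₂ , x₃) (v₁ , v₂ , v₃) (w₁ , w₂ , w₃) (a₁ , a₂ , a₃)))
               refl x₁ x₂ x₃ v₁ v₂ v₃ w₁ w₂ w₃ a₁ a₂ a₃
    , solve 12 (λ x₁ x₂ x₃ v₁ v₂ v₃ w₁ w₂ w₃ a₁ a₂ a₃ →
                  proj₁ (proj₂ (equations (x₁ , x₂ , x₃) (v₁ , v₂ , v₃) (w₁ , w₂ , w₃) (a₁ , a₂ , a₃))))
               refl x₁ x₂ x₃ v₁ v₂ v₃ w₁ w₂ w₃ a₁ a₂ a₃
    , solve 12 (λ x₁ x₂ x₃ v₁ v₂ v₃ w₁ w₂ w₃ a₁ a₂ a₃ →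
                  proj₂ (proj₂ (equations (x₁ , x₂ , x₃) (v₁ , v₂ , v₃) (w₁ , w₂ , w₃) (a₁ , a₂ , a₃))))
               refl x₁ x₂ x₃ v₁ v₂ v₃ w₁ w₂ w₃ a₁ a₂ a₃
    where
    equations : ∀ {n} (x v w a : Vec3 {n}) → Equation × Equation × Equation
    equations x v w a =
      (:det x v w :· a) :=ₚ ((:det a v w :· x) :⊕ ((:det x a w :· v) :⊕ (:det x v a :· w)))

  e₁ e₂ e₃ : Point
  e₁ = (1# , 0# , 0#)
  e₂ = (0# , 1# , 0#)
  e₃ = (0# , 0# , 1#)

  _⨯_ : Point → Point → Point
  v ⨯ w = (det e₁ v w , det e₂ v w , det e₃ v w)

  det-basis : ∀ w → (det e₂ e₃ w , det e₃ e₁ w , det e₁ e₂ w) ≈ₚ w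
  det-basis (w₁ , w₂ , w₃) =
      solve 3 (λ w₁ w₂ w₃ → :det :e₂ :e₃ (w₁ , w₂ , w₃) := w₁) refl w₁ w₂ w₃
    , solve 3 (λ w₁ w₂ w₃ → :det :e₃ :e₁ (w₁ , w₂ , w₃) := w₂) refl w₁ w₂ w₃
    , solve 3 (λ w₁ w₂ w₃ → :det :e₁ :e₂ (w₁ , w₂ , w₃) := w₃) refl w₁ w₂ w₃

  det-relative : ∀ a b c → det a b c ≈ det a (b ⊖ a) (c ⊖ a)
  det-relative (a₁ , a₂ , a₃) (b₁ , b₂ , b₃) (c₁ , c₂ , c₃) =
    solve 9 (λ a₁ a₂ a₃ b₁ b₂ b₃ c₁ c₂ c₃ →
      let a = (a₁ , a₂ , a₃) ; b = (b₁ , b₂ , b₃) ; c = (c₁ , c₂ , c₃)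
      in :det a b c := :det a (b :⊖ a) (c :⊖ a))
      refl a₁ a₂ a₃ b₁ b₂ b₃ c₁ c₂ c₃

  det-affine-combination : ∀ a b c s t u → det a b ((s · a) ⊕ ((t · b) ⊕ (u · c))) ≈ u * det a b c
  det-affine-combination (a₁ , a₂ , a₃) (b₁ , b₂ , b₃) (c₁ , c₂ , c₃) s t u =
    solve 12 (λ a₁ a₂ a₃ b₁ b₂ b₃ c₁ c₂ c₃ s t u →
      let a = (a₁ , a₂ , a₃) ; b = (b₁ , b₂ , b₃) ; c = (c₁ , c₂ , c₃)
      in :det a b ((s :· a) :⊕ ((t :· b) :⊕ (u :· c))) := u :* :det a b c)
      refl a₁ a₂ a₃ b₁ b₂ b₃ c₁ c₂ c₃ s t u

  det-linear-combinations : ∀ v w z t u t′ u′ →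
    det v ((t · v) ⊕ (u · w)) ((t′ · v) ⊕ (u′ · z)) ≈ (u * u′) * det v w z
  det-linear-combinations (v₁ , v₂ , v₃) (w₁ , w₂ , w₃) (z₁ , z₂ , z₃) t u t′ u′ =
    solve 13 (λ v₁ v₂ v₃ w₁ w₂ w₃ z₁ z₂ z₃ t u t′ u′ →
      let v = (v₁ , v₂ , v₃) ; w = (w₁ , w₂ , w₃) ; z = (z₁ , z₂ , z₃)
      in :det v ((t :· v) :⊕ (u :· w)) ((t′ :· v) :⊕ (u′ :· z)) := (u :* u′) :* :det v w z)
      refl v₁ v₂ v₃ w₁ w₂ w₃ z₁ z₂ z₃ t u t′ u′

  LinearlyIndependent : Point → Point → Set (c ⊔ ℓ)
  LinearlyIndependent v w = ∀ s t → ((s · v) ⊕ (t · w)) ≈ₚ origin → (s ≈ 0#) × (t ≈ 0#)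

  cramer-coplanar : ∀ x v w a → det a v w ≈ 0# →
    (det x v w · a) ≈ₚ ((det x a w · v) ⊕ (det x v a · w))
  cramer-coplanar x v w a δ≈0 =
    let (c₁ , c₂ , c₃) = cramer x v w a in drop c₁ , drop c₂ , drop c₃
    where
    drop : ∀ {y xᵢ r} → y ≈ det a v w * xᵢ + r → y ≈ r
    drop eq = trans eq (trans (+-congʳ (trans (*-congʳ δ≈0) (zeroˡ _))) (+-identityˡ _))

  coplanar-exchange : ∀ {v w} x y → LinearlyIndependent v w →
    det x v w ≈ 0# → det y v w ≈ 0# → det x y w ≈ 0#
  coplanar-exchange {v} {w} x y independent x≈0 y≈0 =
    let (c₁ , c₂ , c₃) = cramer-coplanar x v w y y≈0
    in proj₁ (independent (det x y w) (det x v y) (vanish c₁ , vanish c₂ , vanish c₃))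
    where
    vanish : ∀ {yᵢ r} → det x v w * yᵢ ≈ r → r ≈ 0#
    vanish eq = trans (sym eq) (trans (*-congʳ x≈0) (zeroˡ _))

  independent⇒⨯≉0 : ∀ {v w} → LinearlyIndependent v w → ¬ (v ⨯ w) ≈ₚ origin
  independent⇒⨯≉0 {v} {w} independent (n₁≈0 , n₂≈0 , n₃≈0) =
    let (b₁ , b₂ , b₃) = det-basis w
    in 1≉0 (proj₂ (independent 0# 1#
         ( only-w (trans (sym b₁) (coplanar-exchange e₂ e₃ independent n₂≈0 n₃≈0))
         , only-w (trans (sym b₂) (coplanar-exchange e₃ e₁ independent n₃≈0 n₁≈0))
         , only-w (trans (sym b₃) (coplanar-exchange e₁ e₂ independent n₁≈0 n₂≈0)))))
    where
    only-w : ∀ {vᵢ wᵢ} → wᵢ ≈ 0# → 0# * vᵢ + 1# * wᵢ ≈ 0#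
    only-w wᵢ≈0 = trans (+-cong (zeroˡ _) (*-identityˡ _)) (trans (+-identityˡ _) wᵢ≈0)

  det≈0⇒origin∈span : ∀ {a b c} x → ¬ det x (b ⊖ a) (c ⊖ a) ≈ 0# → det a b c ≈ 0# →
    InSpan3 a b c origin
  det≈0⇒origin∈span {a} {b} {c} x D≉0 det≈0 =
    let (c₁ , c₂ , c₃) = cramer-coplanar x v w a (trans (sym (det-relative a b c)) det≈0)
    in 1# - t - u , t , u , sum≈1 , component c₁ , component c₂ , component c₃
    where
    v = b ⊖ a
    w = c ⊖ a
    D = det x v w
    m = D ⁻¹
    α = det x a w
    β = det x v a
    t = - (m * α)
    u = - (m * β)

    sum≈1 : 1# - t - u + t + u ≈ 1#
    sum≈1 = solve 2 (λ t u → con (+ 1) :- t :- u :+ t :+ u := con (+ 1)) refl t u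

    component : ∀ {aᵢ bᵢ cᵢ} → D * aᵢ ≈ α * (bᵢ - aᵢ) + β * (cᵢ - aᵢ) →
      0# ≈ (1# - t - u) * aᵢ + (t * bᵢ + u * cᵢ)
    component {aᵢ} {bᵢ} {cᵢ} cramerᵢ = sym (begin
      (1# - t - u) * aᵢ + (t * bᵢ + u * cᵢ)
        ≈⟨ solve 6 (λ aᵢ bᵢ cᵢ m α β →
             (con (+ 1) :- :- (m :* α) :- :- (m :* β)) :* aᵢ :+ (:- (m :* α) :* bᵢ :+ :- (m :* β) :* cᵢ)
             := aᵢ :- m :* (α :* (bᵢ :- aᵢ) :+ β :* (cᵢ :- aᵢ))) refl aᵢ bᵢ cᵢ m α β ⟩
      aᵢ - m * (α * (bᵢ - aᵢ) + β * (cᵢ - aᵢ))  ≈⟨ +-congˡ (-‿cong (*-congˡ cramerᵢ)) ⟨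
      aᵢ - m * (D * aᵢ)
        ≈⟨ solve 3 (λ aᵢ m D → aᵢ :- m :* (D :* aᵢ) := (con (+ 1) :- D :* m) :* aᵢ) refl aᵢ m D ⟩
      (1# - D * m) * aᵢ                         ≈⟨ *-congʳ (+-congˡ (-‿cong (⁻¹-inverse D D≉0))) ⟩
      (1# - 1#) * aᵢ                            ≈⟨ *-congʳ (-‿inverseʳ 1#) ⟩
      0# * aᵢ                                   ≈⟨ zeroˡ aᵢ ⟩
      0#                                        ∎)

  det≉0 : ∀ {a b c} → TwoDimensional a b c → ¬ InSpan3 a b c origin → ¬ det a b c ≈ 0#
  -- Equality in F need not be decidable, so a coordinate of (b ⊖ a) ⨯ (c ⊖ a)
  -- that is ≉ 0 is only found under a double negation; the goal is negative.
  det≉0 {a} {b} {c} independent 0∉span det≈0 =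
    coordinate e₁ λ n₁≈0 → coordinate e₂ λ n₂≈0 → coordinate e₃ λ n₃≈0 →
      independent⇒⨯≉0 independent (n₁≈0 , n₂≈0 , n₃≈0)
    where
    coordinate : ∀ x → ¬ ¬ det x (b ⊖ a) (c ⊖ a) ≈ 0#
    coordinate x D≉0 = 0∉span (det≈0⇒origin∈span x D≉0 det≈0)

  third-coefficient≉0 : ∀ {a b c d x s t u} → s + t + u ≈ 1# →
    x ≈ₚ ((s · a) ⊕ ((t · b) ⊕ (u · c))) → ¬ InSpan3 a b d x → ¬ u ≈ 0#
  third-coefficient≉0 {s = s} {t} {u} sum≈1 (x₁≈ , x₂≈ , x₃≈) x∉span u≈0 =
    x∉span (s , t , 0# , trans (+-congˡ (sym u≈0)) sum≈1 , drop x₁≈ , drop x₂≈ , drop x₃≈)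
    where
    drop : ∀ {xᵢ aᵢ bᵢ cᵢ dᵢ} → xᵢ ≈ s * aᵢ + (t * bᵢ + u * cᵢ) → xᵢ ≈ s * aᵢ + (t * bᵢ + 0# * dᵢ)
    drop eq = trans eq (+-congˡ (+-congˡ (trans (*-congʳ u≈0) (trans (zeroˡ _) (sym (zeroˡ _))))))

  affine-relative : ∀ {a b c x s t u} → s + t + u ≈ 1# →
    x ≈ₚ ((s · a) ⊕ ((t · b) ⊕ (u · c))) → (x ⊖ a) ≈ₚ ((t · (b ⊖ a)) ⊕ (u · (c ⊖ a)))
  affine-relative {s = s} {t} {u} sum≈1 (x₁≈ , x₂≈ , x₃≈) =
    relative x₁≈ , relative x₂≈ , relative x₃≈
    where
    relative : ∀ {xᵢ aᵢ bᵢ cᵢ} → xᵢ ≈ s * aᵢ + (t * bᵢ + u * cᵢ) →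
      xᵢ - aᵢ ≈ t * (bᵢ - aᵢ) + u * (cᵢ - aᵢ)
    relative {xᵢ} {aᵢ} {bᵢ} {cᵢ} eq = begin
      xᵢ - aᵢ                                                ≈⟨ +-congʳ eq ⟩
      s * aᵢ + (t * bᵢ + u * cᵢ) - aᵢ
        ≈⟨ solve 6 (λ s t u aᵢ bᵢ cᵢ →
             s :* aᵢ :+ (t :* bᵢ :+ u :* cᵢ) :- aᵢ
             := (s :+ t :+ u :- con (+ 1)) :* aᵢ :+ (t :* (bᵢ :- aᵢ) :+ u :* (cᵢ :- aᵢ)))
             refl s t u aᵢ bᵢ cᵢ ⟩
      (s + t + u - 1#) * aᵢ + (t * (bᵢ - aᵢ) + u * (cᵢ - aᵢ))
        ≈⟨ +-congʳ (trans (*-congʳ (trans (+-congʳ sum≈1) (-‿inverseʳ 1#))) (zeroˡ aᵢ)) ⟩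
      0# + (t * (bᵢ - aᵢ) + u * (cᵢ - aᵢ))                  ≈⟨ +-identityˡ _ ⟩
      t * (bᵢ - aᵢ) + u * (cᵢ - aᵢ)                          ∎

  invertible⇒≉0 : ∀ {x y} → x * y ≈ 1# → ¬ x ≈ 0#
  invertible⇒≉0 xy≈1 x≈0 = 1≉0 (trans (sym xy≈1) (trans (*-congʳ x≈0) (zeroˡ _)))

  inverse-unique : ∀ {x y z} → x * y ≈ 1# → x * z ≈ 1# → y ≈ z
  inverse-unique {x} {y} {z} xy≈1 xz≈1 = begin
    y              ≈⟨ *-identityʳ y ⟨
    y * 1#         ≈⟨ *-congˡ xz≈1 ⟨
    y * (x * z)    ≈⟨ *-assoc y x z ⟨
    (y * x) * z    ≈⟨ *-congʳ (trans (*-comm y x) xy≈1) ⟩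
    1# * z         ≈⟨ *-identityˡ z ⟩
    z              ∎

  *-inverse : ∀ {x y} → ¬ x ≈ 0# → ¬ y ≈ 0# → (x * y) * (x ⁻¹ * y ⁻¹) ≈ 1#
  *-inverse {x} {y} x≉0 y≉0 = begin
    (x * y) * (x ⁻¹ * y ⁻¹)      ≈⟨ *-interchange x y (x ⁻¹) (y ⁻¹) ⟩
    (x * x ⁻¹) * (y * y ⁻¹)      ≈⟨ *-cong (⁻¹-inverse x x≉0) (⁻¹-inverse y y≉0) ⟩
    1# * 1#                      ≈⟨ *-identityˡ 1# ⟩
    1#                           ∎

  *-≉0 : ∀ {x y} → ¬ x ≈ 0# → ¬ y ≈ 0# → ¬ x * y ≈ 0#
  *-≉0 x≉0 y≉0 = invertible⇒≉0 (*-inverse x≉0 y≉0)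

  scaled-fraction : ∀ {k p q p′ q′} → ¬ k ≈ 0# → ¬ q ≈ 0# →
    p′ ≈ k * p → q′ ≈ k * q → p′ * q′ ⁻¹ ≈ p * q ⁻¹
  scaled-fraction {k} {p} {q} {p′} {q′} k≉0 q≉0 p′≈kp q′≈kq = begin
    p′ * q′ ⁻¹                 ≈⟨ *-cong p′≈kp (inverse-unique (⁻¹-inverse q′ q′≉0) q′-inverse) ⟩
    (k * p) * (k ⁻¹ * q ⁻¹)    ≈⟨ *-interchange k p (k ⁻¹) (q ⁻¹) ⟩
    (k * k ⁻¹) * (p * q ⁻¹)    ≈⟨ *-congʳ (⁻¹-inverse k k≉0) ⟩
    1# * (p * q ⁻¹)            ≈⟨ *-identityˡ _ ⟩
    p * q ⁻¹                   ∎
    where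
    q′-inverse : q′ * (k ⁻¹ * q ⁻¹) ≈ 1#
    q′-inverse = trans (*-congʳ q′≈kq) (*-inverse k≉0 q≉0)
    q′≉0 : ¬ q′ ≈ 0#
    q′≉0 = invertible⇒≉0 q′-inverse

proposition2p2 : {c ℓ : Level} (F : Field c ℓ) →
    let open Field F
        open Geometry F
    in (p₁ p₂ p₃ p₄ p₃′ p₄′ : Point) →
       TwoDimensional p₁ p₂ p₃ → TwoDimensional p₁ p₂ p₄ →
       ¬ InSpan3 p₁ p₂ p₃ origin → ¬ InSpan3 p₁ p₂ p₄ origin →
       ¬ InSpan3 p₁ p₂ p₄ p₃ → ¬ InSpan3 p₁ p₂ p₃ p₄ →
       InSpan3 p₁ p₂ p₃ p₃′ → ¬ InSpan3 p₁ p₂ p₄ p₃′ →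
       InSpan3 p₁ p₂ p₄ p₄′ → ¬ InSpan3 p₁ p₂ p₃ p₄′ →
       ω p₁ p₂ p₃′ p₄′ ≈ ω p₁ p₂ p₃ p₄
proposition2p2 F p₁ p₂ p₃ p₄ p₃′ p₄′ π₁-plane π₂-plane O∉π₁ O∉π₂ _ _
               (s , t , u , Σ≈1 , p₃′≈) p₃′∉π₂ (s′ , t′ , u′ , Σ′≈1 , p₄′≈) p₄′∉π₁ =
  scaled-fraction (*-≉0 u≉0 u′≉0) (*-≉0 (det≉0 π₁-plane O∉π₁) (det≉0 π₂-plane O∉π₂))
    numerator denominator
  where
  open Field F
  open Geometry F
  open AffineGeometry F
  open CommutativeSemigroupProperties *-commutativeSemigroup using (interchange)

  u≉0 : ¬ u ≈ 0#
  u≉0 = third-coefficient≉0 Σ≈1 p₃′≈ p₃′∉π₂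

  u′≉0 : ¬ u′ ≈ 0#
  u′≉0 = third-coefficient≉0 Σ′≈1 p₄′≈ p₄′∉π₁

  numerator : det (p₂ ⊖ p₁) (p₃′ ⊖ p₁) (p₄′ ⊖ p₁)
              ≈ (u * u′) * det (p₂ ⊖ p₁) (p₃ ⊖ p₁) (p₄ ⊖ p₁)
  numerator = trans (det-cong ≈ₚ-refl (affine-relative Σ≈1 p₃′≈) (affine-relative Σ′≈1 p₄′≈))
                    (det-linear-combinations (p₂ ⊖ p₁) (p₃ ⊖ p₁) (p₄ ⊖ p₁) t u t′ u′)

  denominator : det p₁ p₂ p₃′ * det p₁ p₂ p₄′ ≈ (u * u′) * (det p₁ p₂ p₃ * det p₁ p₂ p₄)
  denominator = trans (*-cong (scaling p₃′≈) (scaling p₄′≈))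
                      (interchange u (det p₁ p₂ p₃) u′ (det p₁ p₂ p₄))
    where
    scaling : ∀ {x p α β γ} → x ≈ₚ ((α · p₁) ⊕ ((β · p₂) ⊕ (γ · p))) → det p₁ p₂ x ≈ γ * det p₁ p₂ p
    scaling {p = p} {α} {β} {γ} x≈ =
      trans (det-cong ≈ₚ-refl ≈ₚ-refl x≈) (det-affine-combination p₁ p₂ p α β γ)
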